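{- Let $A\subseteq\mathbb{N}$ be arbitrary, and let $B\subseteq\mathbb{N}$ be such that neither $B$ nor $\mathbb{N}\setminus B$ is negligible. Then there exists a uniform total function $f\colon\mathbb{N}\to\mathbb{N}$ that reduces $A$ to $B$, i.e., $f(A)\subseteq B$ and $f(\mathbb{N}\setminus A)\subseteq \mathbb{N}\setminus B$.
   Context: For $A\subseteq \mathbb{N}$ and $n\ge 1$, $\rho_n(A) = \#\{k<n \mid k\in A\}/n$. A set $A$ is negligible if $\lim_n \rho_n(A)=0$. A total function $f\colon\mathbb{N}\to\mathbb{N}$ is uniform if $f^{ -1}(S)$ is negligible for every negligible $S\subseteq\mathbb{N}$. No computability is assumed. -}

module Defs where

open import Data.Bool using (Bool; true; false; not)
open import Data.Nat using (ℕ; zero; suc; _≤_)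
open import Data.Integer using (+_)
open import Data.Rational using (ℚ; _/_; _<_; 0ℚ)
open import Data.Product using (∃)
open import Relation.Binary.PropositionalEquality using (_≡_)

SubsetN : Set
SubsetN = ℕ → Bool

co : SubsetN → SubsetN
co A k = not (A k)

count : ℕ → SubsetN → ℕ
count zero    A = zero
count (suc n) A with A n
... | true  = suc (count n A)
... | false = count n A

-- ρ n A for n ≥ 1, written with n = suc m:  ρ (suc m) A = count (suc m) A / (suc m)
ρ : (m : ℕ) → SubsetN → ℚ
ρ m A = (+ count (suc m) A) / suc m

-- A is negligible iff lim_n ρ_n(A) = 0 (ρ_n ≥ 0, so |ρ_n - 0| = ρ_n)
Negligible : SubsetN → Set
Negligible A = ∀ (ε : ℚ) → 0ℚ < ε → ∃ λ N → ∀ m → N ≤ m → ρ m A < ε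

preimage : (ℕ → ℕ) → SubsetN → SubsetN
preimage f S k = S (f k)

Uniform : (ℕ → ℕ) → Set
Uniform f = ∀ (S : SubsetN) → Negligible S → Negligible (preimage f S)

Reduces : (ℕ → ℕ) → SubsetN → SubsetN → Set
Reduces f A B = (∀ n → A n ≡ true → B (f n) ≡ true) × (∀ n → A n ≡ false → B (f n) ≡ false)
  where open import Data.Product using (_×_)

module Submission where

-- Write Sparse S for the integer form of negligibility
-- (for every K, eventually K · #(S ∩ [0,M)) < M); it is equivalent to
-- Negligible S.  If B is not negligible then, classically, B has positive
-- upper density: for some d there are arbitrarily large M with
-- M ≤ d · #(B ∩ [0,M)).  Choosing such M as cut points growing at least
-- geometrically, we let g run, on the block [cut j, cut (j+1)), cyclically
-- through the c_j = #(B ∩ [0, cut j)) elements of B below cut j.  Then g maps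
-- into B, and each element of B ∩ [0, cut j) has at most ⌈t / c_j⌉ preimages
-- among the first t points of block j, so the preimage of a sparse S grows
-- within a block by at most a (d/K)-fraction of its length once S is
-- K-sparse; summing over the geometric blocks makes g uniform.  Doing this
-- for B and for ℕ ∖ B, the reduction f k = if A k then g₁ k else g₂ k is
-- uniform because preimages under f are covered by those under g₁ and g₂.

open import Defs
open import Level using (0ℓ)
open import Axiom.ExcludedMiddle using (ExcludedMiddle)
open import Axiom.DoubleNegationElimination using (em⇒dne)
open import Data.Bool using (Bool; true; false; not; if_then_else_; _∧_)
open import Data.Nat using (ℕ; zero; suc; _+_; _*_; _∸_; _≤_; _<_; s≤s; z≤n; _<?_; _≟_; NonZero; >-nonZero)
open import Data.Nat.Properties
open import Algebra.Properties.CommutativeSemigroup +-commutativeSemigroup using (interchange) renaming (x∙yz≈y∙xz to +-swap)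
open import Algebra.Properties.CommutativeSemigroup *-commutativeSemigroup using () renaming (x∙yz≈y∙xz to *-swap)
open import Data.Nat.DivMod using (_/_; _%_; m%n<n; m<n⇒m%n≡m; [m+kn]%n≡m%n; m≡m%n+[m/n]*n; m/n*n≤m)
open import Data.Product using (∃; _×_; _,_; proj₁; proj₂)
open import Data.Sum using (_⊎_; inj₁; inj₂)
open import Data.Empty using (⊥-elim)
open import Function using (_∘_)
open import Relation.Nullary using (¬_; yes; no)
open import Relation.Nullary.Decidable using (⌊_⌋)
open import Relation.Binary.Definitions using (tri<; tri≈; tri>)
open import Relation.Binary.PropositionalEquality

Sparse : SubsetN → Set
Sparse S = ∀ K → ∃ λ N → ∀ M → N ≤ M → K * count M S < M

-- Sparse S ⇔ Negligible S: ρ_{m+1}(S) < 1/(K+1) forces K · count < m+1, and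
-- conversely d · count < m+1 ≤ p · (m+1) gives ρ_{m+1}(S) < p/d.
module NegligibleBridge where
  open import Data.Integer as ℤ using (+_; -[1+_]; +<+)
  import Data.Integer.Properties as ℤ
  open import Data.Rational as ℚ using (ℚ; mkℚ; toℚᵘ; fromℚᵘ; 0ℚ)
  open import Data.Rational.Properties using (toℚᵘ-mono-<; toℚᵘ-cancel-<; toℚᵘ-fromℚᵘ)
  open import Data.Rational.Unnormalised as ℚᵘ using (mkℚᵘ; *<*)
  import Data.Rational.Unnormalised.Properties as ℚᵘ

  ρ<⇒ : ∀ m A ε → ρ m A ℚ.< ε → mkℚᵘ (+ count (suc m) A) m ℚᵘ.< toℚᵘ ε
  ρ<⇒ m A ε h = ℚᵘ.<-respˡ-≃ (toℚᵘ-fromℚᵘ _) (toℚᵘ-mono-< h)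

  ⇒ρ< : ∀ m A ε → mkℚᵘ (+ count (suc m) A) m ℚᵘ.< toℚᵘ ε → ρ m A ℚ.< ε
  ⇒ρ< m A ε h = toℚᵘ-cancel-< (ℚᵘ.<-respˡ-≃ (ℚᵘ.≃-sym (toℚᵘ-fromℚᵘ _)) h)

  ℤ<⇒ℕ< : ∀ a b c d → + a ℤ.* + b ℤ.< + c ℤ.* + d → a * b < c * d
  ℤ<⇒ℕ< a b c d h rewrite sym (ℤ.pos-* a b) | sym (ℤ.pos-* c d) = ℤ.drop‿+<+ h

  ℕ<⇒ℤ< : ∀ a b c d → a * b < c * d → + a ℤ.* + b ℤ.< + c ℤ.* + d
  ℕ<⇒ℤ< a b c d h rewrite sym (ℤ.pos-* a b) | sym (ℤ.pos-* c d) = +<+ h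

  negligible⇒sparse : ∀ S → Negligible S → Sparse S
  negligible⇒sparse S negligible K =
    suc (proj₁ small) , λ { zero () ; (suc m) (s≤s N≤m) → bound m (proj₂ small m N≤m) }
    where
    ε : ℚ
    ε = fromℚᵘ (mkℚᵘ (+ 1) K)
    ε-pos : 0ℚ ℚ.< ε
    ε-pos = toℚᵘ-cancel-< {0ℚ} {ε}
      (ℚᵘ.<-respʳ-≃ (ℚᵘ.≃-sym (toℚᵘ-fromℚᵘ (mkℚᵘ (+ 1) K)))
        (*<* {mkℚᵘ (+ 0) 0} {mkℚᵘ (+ 1) K} (+<+ (s≤s z≤n))))
    small : ∃ λ N → ∀ m → N ≤ m → ρ m S ℚ.< ε
    small = negligible ε ε-pos
    bound : ∀ m → ρ m S ℚ.< ε → K * count (suc m) S < suc m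
    bound m h with ℚᵘ.<-respʳ-≃ (toℚᵘ-fromℚᵘ (mkℚᵘ (+ 1) K)) (ρ<⇒ m S ε h)
    ... | *<* cross = begin-strict
        K * s       ≤⟨ m≤m+n (K * s) s ⟩
        K * s + s   ≡⟨ +-comm (K * s) s ⟩
        suc K * s   ≡⟨ *-comm (suc K) s ⟩
        s * suc K   <⟨ ℤ<⇒ℕ< s (suc K) 1 (suc m) cross ⟩
        1 * suc m   ≡⟨ *-identityˡ (suc m) ⟩
        suc m       ∎
      where
      open ≤-Reasoning
      s : ℕ
      s = count (suc m) S

  sparse⇒negligible : ∀ S → Sparse S → Negligible S
  sparse⇒negligible S sparse ε@(mkℚ n d-1 _) ε-pos = positive n refl (toℚᵘ-mono-< ε-pos)
    where
    positive : ∀ n′ → n′ ≡ n → mkℚᵘ (+ 0) 0 ℚᵘ.< toℚᵘ ε → ∃ λ N → ∀ m → N ≤ m → ρ m S ℚ.< ε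
    positive (+ zero) refl (*<* (+<+ ()))
    positive -[1+ _ ] refl (*<* ())
    positive (+ suc p) refl _ =
      proj₁ few , λ m N≤m → ⇒ρ< m S ε (*<* (ℕ<⇒ℤ< (count (suc m) S) (suc d-1) (suc p) (suc m) (bound m N≤m)))
      where
      few : ∃ λ N → ∀ M → N ≤ M → suc d-1 * count M S < M
      few = sparse (suc d-1)
      bound : ∀ m → proj₁ few ≤ m → count (suc m) S * suc d-1 < suc p * suc m
      bound m N≤m = begin-strict
          s * suc d-1       ≡⟨ *-comm s (suc d-1) ⟩
          suc d-1 * s       <⟨ proj₂ few (suc m) (m≤n⇒m≤1+n N≤m) ⟩
          suc m             ≤⟨ m≤n*m (suc m) (suc p) ⟩
          suc p * suc m     ∎
        where
        open ≤-Reasoning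
        s : ℕ
        s = count (suc m) S

open NegligibleBridge using (negligible⇒sparse; sparse⇒negligible)

χ : Bool → ℕ
χ true  = 1
χ false = 0

count-suc : ∀ n A → count (suc n) A ≡ χ (A n) + count n A
count-suc n A with A n
... | true  = refl
... | false = refl

count-≤ : ∀ n A → count n A ≤ n
count-≤ zero    A = z≤n
count-≤ (suc n) A rewrite count-suc n A with A n
... | true  = s≤s (count-≤ n A)
... | false = m≤n⇒m≤1+n (count-≤ n A)

count-cong : ∀ n P Q → (∀ i → i < n → P i ≡ Q i) → count n P ≡ count n Q
count-cong zero    P Q same = refl
count-cong (suc n) P Q same rewrite count-suc n P | count-suc n Q | same n ≤-refl =
  cong (χ (Q n) +_) (count-cong n P Q (λ i i<n → same i (m≤n⇒m≤1+n i<n)))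

count-split : ∀ a b P → count (b + a) P ≡ count a P + count b (λ i → P (i + a))
count-split a zero    P = sym (+-identityʳ _)
count-split a (suc b) P = begin
    count (suc b + a) P                                 ≡⟨ count-suc (b + a) P ⟩
    χ (P (b + a)) + count (b + a) P                     ≡⟨ cong (χ (P (b + a)) +_) (count-split a b P) ⟩
    χ (P (b + a)) + (count a P + count b Q)             ≡⟨ +-swap (χ (P (b + a))) (count a P) (count b Q) ⟩
    count a P + (χ (P (b + a)) + count b Q)             ≡⟨ cong (count a P +_) (sym (count-suc b Q)) ⟩
    count a P + count (suc b) Q                         ∎
  where
  open ≡-Reasoning
  Q : SubsetN
  Q i = P (i + a)

count-mono : ∀ {m n} A → m ≤ n → count m A ≤ count n A
count-mono {m} {n} A m≤n = begin
  count m A                                    ≤⟨ m≤m+n (count m A) _ ⟩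
  count m A + count (n ∸ m) (λ i → A (i + m))  ≡⟨ sym (count-split m (n ∸ m) A) ⟩
  count (n ∸ m + m) A                          ≡⟨ cong (λ x → count x A) (m∸n+n≡m m≤n) ⟩
  count n A                                    ∎
  where open ≤-Reasoning

count-subadditive : ∀ n C P Q → (∀ i → χ (C i) ≤ χ (P i) + χ (Q i)) → count n C ≤ count n P + count n Q
count-subadditive zero    C P Q cover = z≤n
count-subadditive (suc n) C P Q cover rewrite count-suc n C | count-suc n P | count-suc n Q = begin
  χ (C n) + count n C                                  ≤⟨ +-mono-≤ (cover n) (count-subadditive n C P Q cover) ⟩
  (χ (P n) + χ (Q n)) + (count n P + count n Q)        ≡⟨ interchange (χ (P n)) (χ (Q n)) (count n P) (count n Q) ⟩
  (χ (P n) + count n P) + (χ (Q n) + count n Q)        ∎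
  where open ≤-Reasoning

count-periodic-full : ∀ c .{{_ : NonZero c}} P q → count (q * c) (λ i → P (i % c)) ≡ q * count c P
count-periodic-full c P zero    = refl
count-periodic-full c P (suc q) = begin
  count (c + q * c) Q                              ≡⟨ count-split (q * c) c Q ⟩
  count (q * c) Q + count c (λ i → Q (i + q * c))  ≡⟨ cong₂ _+_ (count-periodic-full c P q) one-period ⟩
  q * X + X                                        ≡⟨ +-comm (q * X) X ⟩
  suc q * X                                        ∎
  where
  open ≡-Reasoning
  Q : SubsetN
  Q i = P (i % c)
  X : ℕ
  X = count c P
  one-period : count c (λ i → Q (i + q * c)) ≡ X
  one-period = count-cong c _ _ (λ i i<c → cong P (trans ([m+kn]%n≡m%n i q c) (m<n⇒m%n≡m i<c)))

-- On any window [0,t) the c-periodic repetition of P is counted at most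
-- ⌈t / c⌉ times as often as P; in the form used below, c · count ≤ (t + c) · X.
count-periodic : ∀ c .{{_ : NonZero c}} P t → c * count t (λ i → P (i % c)) ≤ (t + c) * count c P
count-periodic c P t = begin
  c * count t Q         ≤⟨ *-monoʳ-≤ c (count-mono Q t≤qc) ⟩
  c * count (q * c) Q   ≡⟨ cong (c *_) (count-periodic-full c P q) ⟩
  c * (q * X)           ≡⟨ *-swap c q X ⟩
  q * (c * X)           ≡⟨ *-assoc q c X ⟨
  (q * c) * X           ≤⟨ *-monoˡ-≤ X qc≤t+c ⟩
  (t + c) * X           ∎
  where
  open ≤-Reasoning
  Q : SubsetN
  Q i = P (i % c)
  X : ℕ
  X = count c P
  q : ℕ
  q = suc (t / c)
  t≤qc : t ≤ q * c
  t≤qc = begin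
    t                     ≡⟨ m≡m%n+[m/n]*n t c ⟩
    t % c + (t / c) * c   ≤⟨ +-monoˡ-≤ ((t / c) * c) (<⇒≤ (m%n<n t c)) ⟩
    q * c                 ∎
  qc≤t+c : q * c ≤ t + c
  qc≤t+c = begin
    c + (t / c) * c       ≤⟨ +-monoʳ-≤ c (m/n*n≤m t c) ⟩
    c + t                 ≡⟨ +-comm c t ⟩
    t + c                 ∎

-- select B M r is the r-th element (from 0) of B ∩ [0, M), when r < count M B:
-- the unique x < M with x ∈ B and count x B = r.
select : SubsetN → ℕ → ℕ → ℕ
select B zero    r = 0
select B (suc M) r = if B M ∧ ⌊ count M B ≟ r ⌋ then M else select B M r

select-∈ : ∀ B M r → r < count M B → B (select B M r) ≡ true
select-∈ B zero    r ()
select-∈ B (suc M) r r<c with B M in M∈B | count M B ≟ r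
... | false | _       = select-∈ B M r r<c
... | true  | yes _   = M∈B
... | true  | no c≢r  = select-∈ B M r (≤∧≢⇒< (≤-pred r<c) (c≢r ∘ sym))

-- r ↦ select B M r is injective on r < count M B with values below M, so it
-- hits any set S at most count M S times.
select-count : ∀ B S M → count (count M B) (λ r → S (select B M r)) ≤ count M S
select-count B S zero    = z≤n
select-count B S (suc M) with B M
... | false = ≤-trans (select-count B S M) (count-mono S (n≤1+n M))
... | true  rewrite count-suc (count M B) (λ r → S (if ⌊ count M B ≟ r ⌋ then M else select B M r))
                  | count-suc M S
            with count M B ≟ count M B
...   | no c≢c = ⊥-elim (c≢c refl)
...   | yes _  = +-monoʳ-≤ (χ (S M)) (begin
          count c (λ r → S (if ⌊ c ≟ r ⌋ then M else select B M r))  ≡⟨ count-cong c _ _ earlier ⟩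
          count c (λ r → S (select B M r))                            ≤⟨ select-count B S M ⟩
          count M S                                                   ∎)
  where
  open ≤-Reasoning
  c : ℕ
  c = count M B
  earlier : ∀ r → r < c → S (if ⌊ c ≟ r ⌋ then M else select B M r) ≡ S (select B M r)
  earlier r r<c with c ≟ r
  ... | yes refl = ⊥-elim (<-irrefl refl r<c)
  ... | no _     = refl

twice : ∀ x → 2 * x ≡ x + x
twice x = cong (x +_) (+-identityʳ x)

linear⇒small : ∀ a .{{_ : NonZero a}} E x x₀ n →
  (a * (2 * E)) * x ≤ (a * (2 * E)) * x₀ + a * n → 2 * E * x₀ < n → E * x < n
linear⇒small a E x x₀ n linear offset = *-cancelˡ-< 2 (E * x) n (begin-strict
    2 * (E * x)         ≡⟨ *-assoc 2 E x ⟨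
    2 * E * x           ≤⟨ scaled ⟩
    2 * E * x₀ + n      <⟨ +-monoˡ-< n offset ⟩
    n + n               ≡⟨ twice n ⟨
    2 * n               ∎)
  where
  open ≤-Reasoning
  scaled : 2 * E * x ≤ 2 * E * x₀ + n
  scaled = *-cancelˡ-≤ a (begin
    a * (2 * E * x)              ≡⟨ *-assoc a (2 * E) x ⟨
    (a * (2 * E)) * x            ≤⟨ linear ⟩
    (a * (2 * E)) * x₀ + a * n   ≡⟨ cong (_+ a * n) (*-assoc a (2 * E) x₀) ⟩
    a * (2 * E * x₀) + a * n     ≡⟨ *-distribˡ-+ a (2 * E * x₀) n ⟨
    a * (2 * E * x₀ + n)         ∎)

Dense : ℕ → SubsetN → Set
Dense d B = ∀ N → ∃ λ M → N ≤ M × M ≤ d * count M B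

module Spread (B : SubsetN) (d : ℕ) (dense : Dense d B) where

  cut : ℕ → ℕ
  cut zero    = proj₁ (dense 1)
  cut (suc j) = proj₁ (dense (2 * cut j))

  c : ℕ → ℕ
  c j = count (cut j) B

  cut-dense : ∀ j → cut j ≤ d * c j
  cut-dense zero    = proj₂ (proj₂ (dense 1))
  cut-dense (suc j) = proj₂ (proj₂ (dense (2 * cut j)))

  cut-double : ∀ j → 2 * cut j ≤ cut (suc j)
  cut-double j = proj₁ (proj₂ (dense (2 * cut j)))

  cut-pos : ∀ j → 0 < cut j
  cut-pos zero    = proj₁ (proj₂ (dense 1))
  cut-pos (suc j) = ≤-trans (cut-pos j) (≤-trans (m≤m+n (cut j) _) (cut-double j))

  cut-< : ∀ j → cut j < cut (suc j)
  cut-< j = begin-strict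
    cut j           <⟨ m<m+n (cut j) (cut-pos j) ⟩
    cut j + cut j   ≡⟨ twice (cut j) ⟨
    2 * cut j       ≤⟨ cut-double j ⟩
    cut (suc j)     ∎
    where open ≤-Reasoning

  cut-mono : ∀ {i j} → i ≤ j → cut i ≤ cut j
  cut-mono {i} {zero}  z≤n = ≤-refl
  cut-mono {i} {suc j} i≤1+j with m≤n⇒m<n∨m≡n i≤1+j
  ... | inj₁ i<1+j = ≤-trans (cut-mono (≤-pred i<1+j)) (<⇒≤ (cut-< j))
  ... | inj₂ refl  = ≤-refl

  index<cut : ∀ j → j < cut j
  index<cut zero    = cut-pos zero
  index<cut (suc j) = ≤-trans (s≤s (index<cut j)) (cut-< j)

  c-pos : ∀ j → 0 < c j
  c-pos j = n≢0⇒n>0 λ c≡0 →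
    <⇒≱ (cut-pos j) (subst (cut j ≤_) (trans (cong (d *_) c≡0) (*-zeroʳ d)) (cut-dense j))

  d-pos : 0 < d
  d-pos = n≢0⇒n>0 λ d≡0 → <⇒≱ (cut-pos 0) (subst (λ e → cut 0 ≤ e * c 0) d≡0 (cut-dense 0))

  slot : ℕ → ℕ → ℕ
  slot j i = _%_ i (c j) {{>-nonZero (c-pos j)}}

  slot-< : ∀ j i → slot j i < c j
  slot-< j i = m%n<n i (c j) {{>-nonZero (c-pos j)}}

  -- block k is the j with cut j ≤ k < cut (suc j); block 0 also covers [0, cut 0).
  block : ℕ → ℕ
  block zero = 0
  block (suc n) with suc n <? cut (suc (block n))
  ... | yes _ = block n
  ... | no  _ = suc (block n)

  block-spec : ∀ n → n < cut (suc (block n)) × (block n ≡ 0 ⊎ cut (block n) ≤ n)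
  block-spec zero = ≤-trans (cut-pos 0) (<⇒≤ (cut-< 0)) , inj₁ refl
  block-spec (suc n) with suc n <? cut (suc (block n)) | block-spec n
  ... | yes below | (_ , inj₁ first) = below , inj₁ first
  ... | yes below | (_ , inj₂ above) = below , inj₂ (m≤n⇒m≤1+n above)
  ... | no ¬below | (n<next , _)     =
    subst (_< cut (suc (suc (block n)))) (sym at-cut) (cut-< (suc (block n))) , inj₂ (≤-reflexive (sym at-cut))
    where
    at-cut : suc n ≡ cut (suc (block n))
    at-cut = ≤-antisym n<next (≮⇒≥ ¬below)

  block-unique : ∀ j k → cut j ≤ k → k < cut (suc j) → block k ≡ j
  block-unique j k lo hi with <-cmp (block k) j | block-spec k
  ... | tri< b<j _ _ | (k<next , _)     = ⊥-elim (<⇒≱ k<next (≤-trans (cut-mono b<j) lo))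
  ... | tri≈ _ b≡j _ | _                = b≡j
  ... | tri> _ _ j<b | (_ , inj₁ b≡0)   = ⊥-elim (<⇒≱ j<b (≤-trans (≤-reflexive b≡0) z≤n))
  ... | tri> _ _ j<b | (_ , inj₂ above) = ⊥-elim (<⇒≱ hi (≤-trans (cut-mono j<b) above))

  block-after : ∀ j₀ n → cut j₀ ≤ n → j₀ ≤ block n × cut (block n) ≤ n × n < cut (suc (block n))
  block-after j₀ n past with block-spec n
  ... | (n<next , lower) = j₀≤b , b-lower lower , n<next
    where
    j₀≤b : j₀ ≤ block n
    j₀≤b = ≮⇒≥ (λ b<j₀ → <⇒≱ n<next (≤-trans (cut-mono b<j₀) past))
    b-lower : block n ≡ 0 ⊎ cut (block n) ≤ n → cut (block n) ≤ n
    b-lower (inj₁ b≡0) = ≤-trans (cut-mono (subst (_≤ j₀) (sym b≡0) z≤n)) past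
    b-lower (inj₂ above) = above

  g : ℕ → ℕ
  g k = select B (cut (block k)) (slot (block k) (k ∸ cut (block k)))

  g-∈ : ∀ k → B (g k) ≡ true
  g-∈ k = select-∈ B (cut (block k)) _ (slot-< (block k) (k ∸ cut (block k)))

  g-on-block : ∀ j k → cut j ≤ k → k < cut (suc j) → g k ≡ select B (cut j) (slot j (k ∸ cut j))
  g-on-block j k lo hi rewrite block-unique j k lo hi = refl

  -- Hits of S by g over the first t points of block j: each element of B below
  -- cut j is used at most ⌈t / c j⌉ times, and cut j ≤ d · c j.
  block-hits : ∀ S j t → t + cut j ≤ cut (suc j) →
    cut j * count t (λ i → S (g (i + cut j))) ≤ d * ((t + cut j) * count (cut j) S)
  block-hits S j t inside = begin
    cut j * Y                                 ≤⟨ *-monoˡ-≤ Y (cut-dense j) ⟩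
    (d * c j) * Y                             ≡⟨ *-assoc d (c j) Y ⟩
    d * (c j * Y)                             ≡⟨ cong (λ x → d * (c j * x)) cyclic ⟩
    d * (c j * count t (P ∘ slot j))          ≤⟨ *-monoʳ-≤ d (count-periodic (c j) {{>-nonZero (c-pos j)}} P t) ⟩
    d * ((t + c j) * count (c j) P)           ≤⟨ *-monoʳ-≤ d (*-mono-≤ (+-monoʳ-≤ t (count-≤ (cut j) B)) (select-count B S (cut j))) ⟩
    d * ((t + cut j) * count (cut j) S)       ∎
    where
    open ≤-Reasoning
    P : SubsetN
    P r = S (select B (cut j) r)
    Y : ℕ
    Y = count t (λ i → S (g (i + cut j)))
    cyclic : Y ≡ count t (P ∘ slot j)
    cyclic = count-cong t _ _ λ i i<t → cong S (trans
      (g-on-block j (i + cut j) (m≤n+m (cut j) i) (<-≤-trans (+-monoˡ-< (cut j) i<t) inside))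
      (cong (select B (cut j) ∘ slot j) (m+n∸n≡m i (cut j))))

  module _ (S : SubsetN) where

    F : ℕ → ℕ
    F n = count n (preimage g S)

    within-block : ∀ K j n → K * count (cut j) S ≤ cut j → cut j ≤ n → n ≤ cut (suc j) →
      K * F n ≤ K * F (cut j) + d * n
    within-block K j n sparse lo hi = begin
      K * F n                  ≡⟨ cong (λ x → K * F x) t+cut≡n ⟨
      K * F (t + cut j)        ≡⟨ cong (K *_) (count-split (cut j) t (preimage g S)) ⟩
      K * (F (cut j) + Δ)      ≡⟨ *-distribˡ-+ K (F (cut j)) Δ ⟩
      K * F (cut j) + K * Δ    ≤⟨ +-monoʳ-≤ (K * F (cut j)) KΔ≤dn ⟩
      K * F (cut j) + d * n    ∎
      where
      open ≤-Reasoning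
      t : ℕ
      t = n ∸ cut j
      t+cut≡n : t + cut j ≡ n
      t+cut≡n = m∸n+n≡m lo
      Δ s : ℕ
      Δ = count t (λ i → S (g (i + cut j)))
      s = count (cut j) S
      KΔ≤dn : K * Δ ≤ d * n
      KΔ≤dn = *-cancelˡ-≤ (cut j) {{>-nonZero (cut-pos j)}} (begin
        cut j * (K * Δ)              ≡⟨ *-swap (cut j) K Δ ⟩
        K * (cut j * Δ)              ≤⟨ *-monoʳ-≤ K (block-hits S j t (subst (_≤ cut (suc j)) (sym t+cut≡n) hi)) ⟩
        K * (d * ((t + cut j) * s))  ≡⟨ cong (λ x → K * (d * (x * s))) t+cut≡n ⟩
        K * (d * (n * s))            ≡⟨ cong (K *_) (*-assoc d n s) ⟨
        K * ((d * n) * s)            ≡⟨ *-swap K (d * n) s ⟩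
        (d * n) * (K * s)            ≤⟨ *-monoʳ-≤ (d * n) sparse ⟩
        (d * n) * cut j              ≡⟨ *-comm (d * n) (cut j) ⟩
        cut j * (d * n)              ∎)

    module _ (K j₀ : ℕ) (sparse : ∀ j → j₀ ≤ j → K * count (cut j) S ≤ cut j) where

      F₀ : ℕ
      F₀ = F (cut j₀)

      at-cut : ∀ i → K * F (cut (i + j₀)) ≤ K * F₀ + 2 * (d * cut (i + j₀))
      at-cut zero    = m≤m+n (K * F₀) _
      at-cut (suc i) = begin
        K * F (cut (suc j))                          ≤⟨ within-block K j (cut (suc j)) (sparse j (m≤n+m j₀ i)) (<⇒≤ (cut-< j)) ≤-refl ⟩
        K * F (cut j) + d * cut (suc j)              ≤⟨ +-monoˡ-≤ (d * cut (suc j)) (at-cut i) ⟩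
        (K * F₀ + 2 * (d * cut j)) + d * cut (suc j) ≤⟨ +-monoˡ-≤ (d * cut (suc j)) (+-monoʳ-≤ (K * F₀) doubled) ⟩
        (K * F₀ + d * cut (suc j)) + d * cut (suc j) ≡⟨ +-assoc (K * F₀) _ _ ⟩
        K * F₀ + (d * cut (suc j) + d * cut (suc j)) ≡⟨ cong (K * F₀ +_) (twice (d * cut (suc j))) ⟨
        K * F₀ + 2 * (d * cut (suc j))               ∎
        where
        open ≤-Reasoning
        j : ℕ
        j = i + j₀
        doubled : 2 * (d * cut j) ≤ d * cut (suc j)
        doubled = ≤-trans (≤-reflexive (*-swap 2 d (cut j))) (*-monoʳ-≤ d (cut-double j))

      linear-bound : ∀ n → cut j₀ ≤ n → K * F n ≤ K * F₀ + 3 * (d * n)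
      linear-bound n past = begin
        K * F n                              ≤⟨ within-block K j n (sparse j j₀≤j) lo (<⇒≤ hi) ⟩
        K * F (cut j) + d * n                ≤⟨ +-monoˡ-≤ (d * n) at-j ⟩
        (K * F₀ + 2 * (d * cut j)) + d * n   ≤⟨ +-monoˡ-≤ (d * n) (+-monoʳ-≤ (K * F₀) (*-monoʳ-≤ 2 (*-monoʳ-≤ d lo))) ⟩
        (K * F₀ + 2 * (d * n)) + d * n       ≡⟨ +-assoc (K * F₀) _ _ ⟩
        K * F₀ + (2 * (d * n) + d * n)       ≡⟨ cong (K * F₀ +_) (+-comm (2 * (d * n)) (d * n)) ⟩
        K * F₀ + 3 * (d * n)                 ∎
        where
        open ≤-Reasoning
        j : ℕ
        j = block n
        j₀≤j : j₀ ≤ j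
        j₀≤j = proj₁ (block-after j₀ n past)
        lo : cut j ≤ n
        lo = proj₁ (proj₂ (block-after j₀ n past))
        hi : n < cut (suc j)
        hi = proj₂ (proj₂ (block-after j₀ n past))
        at-j : K * F (cut j) ≤ K * F₀ + 2 * (d * cut j)
        at-j = subst (λ x → K * F (cut x) ≤ K * F₀ + 2 * (d * cut x)) (m∸n+n≡m j₀≤j) (at-cut (j ∸ j₀))

  -- g is uniform: to get E · F n < n eventually, use the bound for K = 3d · 2E.
  g-uniform : ∀ S → Sparse S → Sparse (preimage g S)
  g-uniform S sparseS E = N , λ n N≤n →
    linear⇒small (3 * d) {{>-nonZero (≤-trans d-pos (m≤m+n d _))}} E (F S n) base n
      (linear n (≤-trans (m≤m+n (cut j₀) _) N≤n)) (≤-trans (m≤n+m _ (cut j₀)) N≤n)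
    where
    K j₀ : ℕ
    K = (3 * d) * (2 * E)
    j₀ = proj₁ (sparseS K)
    sparse : ∀ j → j₀ ≤ j → K * count (cut j) S ≤ cut j
    sparse j j₀≤j = <⇒≤ (proj₂ (sparseS K) (cut j) (≤-trans (<⇒≤ (index<cut j₀)) (cut-mono j₀≤j)))
    base N : ℕ
    base = F₀ S K j₀ sparse
    N = cut j₀ + suc (2 * E * base)
    linear : ∀ n → cut j₀ ≤ n → K * F S n ≤ K * base + (3 * d) * n
    linear n past = subst (λ x → K * F S n ≤ K * base + x) (sym (*-assoc 3 d n)) (linear-bound S K j₀ sparse n past)

not-sparse⇒dense : ExcludedMiddle 0ℓ → ∀ B → ¬ Sparse B → ∃ λ d → Dense d B
not-sparse⇒dense em B ¬sparse =
  dne λ ¬dense → ¬sparse λ K → dne λ ¬eventually → ¬dense (K , λ N → dne λ ¬witness →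
    ¬eventually (N , λ M N≤M → ≰⇒> λ M≤dB → ¬witness (M , N≤M , M≤dB)))
  where
  dne : ∀ {P : Set} → ¬ ¬ P → P
  dne = em⇒dne em

uniform-into : ExcludedMiddle 0ℓ → ∀ B → ¬ Negligible B →
  ∃ λ (g : ℕ → ℕ) → (∀ k → B (g k) ≡ true) × Uniform g
uniform-into em B ¬negligible with not-sparse⇒dense em B (¬negligible ∘ sparse⇒negligible B)
... | d , dense = g , g-∈ , λ S negligible → sparse⇒negligible _ (g-uniform S (negligible⇒sparse S negligible))
  where open Spread B d dense

sparse-cover : ∀ C P Q → Sparse P → Sparse Q → (∀ i → χ (C i) ≤ χ (P i) + χ (Q i)) → Sparse C
sparse-cover C P Q sparseP sparseQ cover K = NP + NQ , λ M N≤M → *-cancelˡ-< 2 (K * count M C) M (begin-strict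
    2 * (K * count M C)                       ≤⟨ *-monoʳ-≤ 2 (*-monoʳ-≤ K (count-subadditive M C P Q cover)) ⟩
    2 * (K * (count M P + count M Q))         ≡⟨ cong (2 *_) (*-distribˡ-+ K (count M P) (count M Q)) ⟩
    2 * (K * count M P + K * count M Q)       ≡⟨ *-distribˡ-+ 2 (K * count M P) (K * count M Q) ⟩
    2 * (K * count M P) + 2 * (K * count M Q) ≡⟨ cong₂ _+_ (*-assoc 2 K _) (*-assoc 2 K _) ⟨
    2 * K * count M P + 2 * K * count M Q     <⟨ +-mono-< (P-small M (≤-trans (m≤m+n NP NQ) N≤M)) (Q-small M (≤-trans (m≤n+m NQ NP) N≤M)) ⟩
    M + M                                     ≡⟨ twice M ⟨
    2 * M                                     ∎)
  where
  open ≤-Reasoning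
  NP NQ : ℕ
  NP = proj₁ (sparseP (2 * K))
  NQ = proj₁ (sparseQ (2 * K))
  P-small : ∀ M → NP ≤ M → 2 * K * count M P < M
  P-small = proj₂ (sparseP (2 * K))
  Q-small : ∀ M → NQ ≤ M → 2 * K * count M Q < M
  Q-small = proj₂ (sparseQ (2 * K))

χ-one-of : ∀ (S : SubsetN) {z x y} → z ≡ x ⊎ z ≡ y → χ (S z) ≤ χ (S x) + χ (S y)
χ-one-of S (inj₁ refl) = m≤m+n _ _
χ-one-of S (inj₂ refl) = m≤n+m _ _

-- A pointwise choice between two uniform maps is uniform: f⁻¹(S) ⊆ g₁⁻¹(S) ∪ g₂⁻¹(S).
uniform-choice : ∀ (f g₁ g₂ : ℕ → ℕ) → (∀ k → f k ≡ g₁ k ⊎ f k ≡ g₂ k) →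
  Uniform g₁ → Uniform g₂ → Uniform f
uniform-choice f g₁ g₂ choice uniform₁ uniform₂ S negligible =
  sparse⇒negligible _ (sparse-cover (preimage f S) (preimage g₁ S) (preimage g₂ S)
    (negligible⇒sparse _ (uniform₁ S negligible)) (negligible⇒sparse _ (uniform₂ S negligible)) covered)
  where
  covered : ∀ k → χ (S (f k)) ≤ χ (S (g₁ k)) + χ (S (g₂ k))
  covered k = χ-one-of S (choice k)

not≡true⇒false : ∀ b → not b ≡ true → b ≡ false
not≡true⇒false false _ = refl

if-choice : ∀ b (x y : ℕ) → (if b then x else y) ≡ x ⊎ (if b then x else y) ≡ y
if-choice true  x y = inj₁ refl
if-choice false x y = inj₂ refl

theorem2 : ExcludedMiddle 0ℓ → (A B : SubsetN) → ¬ Negligible B → ¬ Negligible (co B)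
    → ∃ λ (f : ℕ → ℕ) → Uniform f × Reduces f A B
theorem2 em A B ¬negligibleB ¬negligible∁B =
  f , uniform-choice f g₁ g₂ choice uniform₁ uniform₂ , A↦B , ∁A↦∁B
  where
  into-B : ∃ λ (g : ℕ → ℕ) → (∀ k → B (g k) ≡ true) × Uniform g
  into-B = uniform-into em B ¬negligibleB
  into-∁B : ∃ λ (g : ℕ → ℕ) → (∀ k → co B (g k) ≡ true) × Uniform g
  into-∁B = uniform-into em (co B) ¬negligible∁B
  g₁ g₂ : ℕ → ℕ
  g₁ = proj₁ into-B
  g₂ = proj₁ into-∁B
  uniform₁ : Uniform g₁
  uniform₁ = proj₂ (proj₂ into-B)
  uniform₂ : Uniform g₂
  uniform₂ = proj₂ (proj₂ into-∁B)
  f : ℕ → ℕ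
  f k = if A k then g₁ k else g₂ k
  choice : ∀ k → f k ≡ g₁ k ⊎ f k ≡ g₂ k
  choice k = if-choice (A k) (g₁ k) (g₂ k)
  A↦B : ∀ n → A n ≡ true → B (f n) ≡ true
  A↦B n n∈A = subst (λ x → B x ≡ true) (sym (cong (λ b → if b then g₁ n else g₂ n) n∈A)) (proj₁ (proj₂ into-B) n)
  ∁A↦∁B : ∀ n → A n ≡ false → B (f n) ≡ false
  ∁A↦∁B n n∉A = subst (λ x → B x ≡ false) (sym (cong (λ b → if b then g₁ n else g₂ n) n∉A))
    (not≡true⇒false (B (g₂ n)) (proj₁ (proj₂ into-∁B) n))
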